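{- For $k\ge1$ and $i\ge1$ let $f^{\mathcal B^i}_{1,k}$ be the number of trees of degree $k$ in $\mathcal G^i$, let $f^{\mathcal B^\infty}_{1,k}$ be the number of trees of degree $k$ in $\mathcal G$, and let $f^{\mathcal B^0}_k$ be the number of forests of degree $k$ in $\mathcal G^0$. Then for all $k\ge1$, $i\ge1$: $$f^{\mathcal B^i}_{1,k}=\begin{cases} f^{\mathcal B^\infty}_{1,k} & \text{if } k\le i+1,\\[2pt] f^{\mathcal B^\infty}_{1,k}-\displaystyle\sum_{1\le j\le k-i-1} f^{\mathcal B^0}_j\, f^{\mathcal B^\infty}_{1,k-j} & \text{if } k\ge i+2.\end{cases}$$
   Context: An ordered forest of degree $n$ is a planar rooted forest (left-to-right sequence of rooted trees, children of each vertex linearly ordered left to right) with $n$ vertices together with a bijection from its vertex set to $\{1,\dots,n\}$ (labels); edges point towards roots; $\bullet_1$ is the one-vertex tree; a tree is a forest with one component. For $n\ge1$ and $\underline\varepsilon=(\varepsilon_1,\dots,\varepsilon_n)\in\{+,-\}^n$ define sets $\mathcal G^{(\underline\varepsilon)}$ of ordered forests of degree $n$ recursively: $\mathcal G^{(\varepsilon_1)}=\{\bullet_1\}$; for $n\ge2$, let $F'$ range over $\mathcal G^{(\varepsilon_1,\dots,\varepsilon_{n-1})}$ with trees $T_1,\dots,T_m$ from left to right; all vertices of $F'$ keep their labels and a new vertex labelled $n$ is added. If $\varepsilon_n=-$: add a new root whose children are the roots of $T_1,\dots,T_m$ in order. If $\varepsilon_n=+$: either add the new vertex as a one-vertex tree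 at the right end, or, for some $1\le i\le m$, attach the new vertex as rightmost child of the root of $T_i$ and make the roots of $T_{i+1},\dots,T_m$ (in order) the children of the new vertex. (Note $\mathcal G^{(\underline\varepsilon)}$ does not depend on $\varepsilon_1$.) $\mathcal G=\bigcup_{n\ge1}\bigcup_{\underline\varepsilon\in\{+,-\}^n}\mathcal G^{(\underline\varepsilon)}$; $\mathcal G^0$ is the union of the $\mathcal G^{(+,\dots,+)}$ over words consisting only of $+$; for $i\ge1$, $\mathcal G^i$ is the union of the sets $\mathcal G^{(\varepsilon_1,\dots,\varepsilon_n)}$ over all $n\ge1$ and all words with $\varepsilon_1=\dots=\varepsilon_{n-i}=+$ (no condition when $n\le i$). -}

module Defs where

open import Data.Nat using (ℕ; zero; suc; _+_; _*_; _∸_; _≟_)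
open import Data.List using (List; []; _∷_; _++_; [_]; map; concatMap; length; reverse; take; filter; deduplicate; upTo)
open import Data.Nat.ListAction using (sum)
open import Data.List.Relation.Unary.All using (All; all?)
open import Relation.Binary.PropositionalEquality using (_≡_; refl; cong; cong₂)
open import Relation.Nullary using (Dec; yes; no; ¬_)
open import Data.Product using (_×_; _,_)

-- Planar labelled rooted trees / forests: a tree is a root label with the
-- left-to-right list of its subtrees; a forest is a left-to-right list of trees.
data Tree : Set where
  node : ℕ → List Tree → Tree

Forest : Set
Forest = List Tree

mutual
  _≟T_ : (s t : Tree) → Dec (s ≡ t)
  node a cs ≟T node b ds with a ≟ b | cs ≟F ds
  ... | yes refl | yes refl = yes refl
  ... | no a≢b | _ = no λ { refl → a≢b refl }
  ... | yes _ | no c≢d = no λ { refl → c≢d refl }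

  _≟F_ : (f g : Forest) → Dec (f ≡ g)
  [] ≟F [] = yes refl
  [] ≟F (_ ∷ _) = no λ ()
  (_ ∷ _) ≟F [] = no λ ()
  (s ∷ f) ≟F (t ∷ g) with s ≟T t | f ≟F g
  ... | yes refl | yes refl = yes refl
  ... | no p | _ = no λ { refl → p refl }
  ... | yes _ | no q = no λ { refl → q refl }

data Sign : Set where
  plus minus : Sign

_≟S_ : (a b : Sign) → Dec (a ≡ b)
plus ≟S plus = yes refl
plus ≟S minus = no λ ()
minus ≟S plus = no λ ()
minus ≟S minus = yes refl

-- For ε_n = + : the options "attach n as rightmost child of the root of T_i and
-- make T_{i+1},…,T_m the children of n", for i = 1,…,m.
attach : ℕ → Forest → List Forest
attach n [] = []
attach n (node a cs ∷ rest) =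
  (node a (cs ++ [ node n rest ]) ∷ []) ∷ map (node a cs ∷_) (attach n rest)

step : Sign → ℕ → Forest → List Forest
step minus n F = [ node n F ∷ [] ]
step plus  n F = (F ++ [ node n [] ]) ∷ attach n F

-- genRev w = G^(ε) where w is the word ε read backwards (ε_n first)
genRev : List Sign → List Forest
genRev [] = []
genRev (e ∷ []) = [ node 1 [] ∷ [] ]
genRev (e ∷ rest@(_ ∷ _)) = concatMap (step e (suc (length rest))) (genRev rest)

G : List Sign → List Forest
G ε = genRev (reverse ε)

words : ℕ → List (List Sign)
words zero = [] ∷ []
words (suc k) = concatMap (λ w → (plus ∷ w) ∷ (minus ∷ w) ∷ []) (words k)

isTree : (F : Forest) → Dec (length F ≡ 1)
isTree F = length F ≟ 1

-- condition defining G^i on words of length k: ε_1 = … = ε_{k-i} = +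
prefixPlus : ℕ → ℕ → List Sign → Set
prefixPlus k i w = All (_≡ plus) (take (k ∸ i) w)

prefixPlus? : (k i : ℕ) (w : List Sign) → Dec (prefixPlus k i w)
prefixPlus? k i w = all? (_≟S plus) (take (k ∸ i) w)

allPlus : List Sign → Set
allPlus w = All (_≡ plus) w

allPlus? : (w : List Sign) → Dec (allPlus w)
allPlus? w = all? (_≟S plus) w

distinct : List Forest → List Forest
distinct = deduplicate _≟F_

fBi : ℕ → ℕ → ℕ
fBi i k = length (filter isTree (distinct (concatMap G (filter (prefixPlus? k i) (words k)))))

fBinf : ℕ → ℕ
fBinf k = length (filter isTree (distinct (concatMap G (words k))))

fB0 : ℕ → ℕ
fB0 k = length (distinct (concatMap G (filter allPlus? (words k))))

sumFrom1 : ℕ → (ℕ → ℕ) → ℕ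
sumFrom1 b g = sum (map (λ j → g (suc j)) (upTo b))

-- Every growth step is injective with pairwise disjoint images: the new vertex n is either
-- the root of the last tree or the last child of that root, so deleting it recovers the
-- forest it was added to.  Hence sign words that differ beyond ε₁ yield different forests,
-- and counting forests means counting growth paths.  Along a path only the number of
-- roots matters: from m roots a +-step leads to m + 1, 1, 2, …, m roots and a −-step to
-- 1 root.  Classify the trees of 𝒢 of degree k by the first position j + 1 > 1 of
-- a − sign.  If j + 1 ≤ k − i, the first j steps build a forest of 𝒢⁰ (f⁰_j choices), the
-- − step merges it into one tree, and the remaining steps grow it exactly as they grow •₁,
-- which gives f^∞_{1,k−j} trees; all other trees of 𝒢 lie in 𝒢^i.
module Submission where

open import Defs
open import Data.Bool using (Bool; true; false; T)
open import Data.Bool.Properties using (T-≡)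
open import Data.Empty using (⊥-elim)
open import Data.List using (List; []; _∷_; _++_; [_]; _∷ʳ_; map; concatMap; length; reverse;
  take; filter; upTo; applyUpTo)
open import Data.List.Membership.Propositional using (_∈_; _∉_; lose; find)
open import Data.List.Membership.Propositional.Properties
  using (∈-++⁺ˡ; ∈-++⁺ʳ; ∈-++⁻; ∈-∃++; ∈-map⁻; ∈-filter⁺; ∈-filter⁻; ∈-concatMap⁺; ∈-concatMap⁻)
open import Data.List.Properties hiding (sum-++)
open import Data.Nat.ListAction.Properties using (sum-++)
open import Data.List.Relation.Binary.Subset.Propositional using (_⊆_)
open import Data.List.Relation.Binary.Subset.Propositional.Properties using (filter⁺′)
open import Data.List.Relation.Unary.All as All using (All; []; _∷_)
import Data.List.Relation.Unary.All.Properties as All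
import Data.List.Relation.Unary.Any.Properties as Any
open import Data.List.Relation.Unary.AllPairs using ([]; _∷_)
open import Data.List.Relation.Unary.Any using (here; there)
open import Data.List.Relation.Unary.Unique.Propositional using (Unique)
import Data.List.Relation.Unary.Unique.Propositional.Properties as Unique
open import Data.List.Relation.Unary.Unique.DecPropositional.Properties using (deduplicate-!)
open import Data.Maybe using (Maybe; just; nothing; maybe′)
open import Data.Nat using (ℕ; zero; suc; _+_; _*_; _∸_; _≤_; _<_; _≟_; _<ᵇ_; _≡ᵇ_; z≤n; s≤s)
open import Data.Nat.ListAction using (sum)
open import Data.Nat.Properties
open import Data.Nat.Solver using (module +-*-Solver)
open import Data.Product using (_×_; _,_; proj₂; ∃-syntax; map₁; uncurry)
open import Data.Sum using (_⊎_; inj₁; inj₂) renaming (map₂ to ⊎-map₂)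
open import Function using (_∘_; id; Equivalence)
open import Relation.Binary.PropositionalEquality hiding ([_])
open import Relation.Nullary using (¬_; yes; no; contradiction)

module _ {A B : Set} {f : A → List B} where

  ∈-concatMap-intro : ∀ {x xs y} → x ∈ xs → y ∈ f x → y ∈ concatMap f xs
  ∈-concatMap-intro x∈ y∈ = ∈-concatMap⁺ f (lose x∈ y∈)

  ∈-concatMap-elim : ∀ {xs y} → y ∈ concatMap f xs → ∃[ x ] x ∈ xs × y ∈ f x
  ∈-concatMap-elim = find ∘ ∈-concatMap⁻ f

  Unique-concatMap : ∀ (g : B → A) {xs} →
    (∀ {x} → x ∈ xs → Unique (f x)) → (∀ {x y} → x ∈ xs → y ∈ f x → g y ≡ x) →
    Unique xs → Unique (concatMap f xs)
  Unique-concatMap g {[]} _ _ [] = []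
  Unique-concatMap g {x ∷ xs} uniq inv (x∉xs ∷ u) =
    Unique.++⁺ (uniq (here refl)) (Unique-concatMap g (uniq ∘ there) (inv ∘ there) u) disjoint
    where
    disjoint : ∀ {y} → ¬ (y ∈ f x × y ∈ concatMap f xs)
    disjoint (y∈fx , y∈rest) with ∈-concatMap-elim y∈rest
    ... | x′ , x′∈xs , y∈fx′ =
      All.lookup x∉xs x′∈xs (trans (sym (inv (here refl) y∈fx)) (inv (there x′∈xs) y∈fx′))

module _ {A : Set} where

  Unique⊆⇒length≤ : ∀ {xs ys : List A} → Unique xs → xs ⊆ ys → length xs ≤ length ys
  Unique⊆⇒length≤ [] _ = z≤n
  Unique⊆⇒length≤ {x ∷ xs} {ys} (x∉xs ∷ u) xs⊆ys with ∈-∃++ (xs⊆ys (here refl))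
  ... | ys₁ , ys₂ , refl =
    ≤-trans (s≤s (Unique⊆⇒length≤ u xs⊆ys₁ys₂)) (≤-reflexive (sym (length-++-sucʳ ys₁ x ys₂)))
    where
    xs⊆ys₁ys₂ : xs ⊆ ys₁ ++ ys₂
    xs⊆ys₁ys₂ z∈xs with ∈-++⁻ ys₁ (xs⊆ys (there z∈xs))
    ... | inj₁ z∈ys₁ = ∈-++⁺ˡ z∈ys₁
    ... | inj₂ (here refl) = ⊥-elim (All.lookup x∉xs z∈xs refl)
    ... | inj₂ (there z∈ys₂) = ∈-++⁺ʳ ys₁ z∈ys₂

  Unique-⊆-⊇⇒length≡ : ∀ {xs ys : List A} → Unique xs → Unique ys → xs ⊆ ys → ys ⊆ xs →
    length xs ≡ length ys
  Unique-⊆-⊇⇒length≡ ux uy xs⊆ys ys⊆xs =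
    ≤-antisym (Unique⊆⇒length≤ ux xs⊆ys) (Unique⊆⇒length≤ uy ys⊆xs)

  All-take-∷ʳ⁻ : ∀ {P : A → Set} n xs {x} → All P (take n (xs ∷ʳ x)) →
    All P (take n xs) × (length xs < n → P x)
  All-take-∷ʳ⁻ zero xs _ = [] , λ ()
  All-take-∷ʳ⁻ (suc n) [] (px ∷ _) = [] , λ _ → px
  All-take-∷ʳ⁻ (suc n) (y ∷ xs) (py ∷ pxs) with All-take-∷ʳ⁻ n xs pxs
  ... | pys , px = py ∷ pys , px ∘ ≤-pred

  All-take-∷ʳ⁺ : ∀ {P : A → Set} n xs {x} → All P (take n xs) → (length xs < n → P x) →
    All P (take n (xs ∷ʳ x))
  All-take-∷ʳ⁺ zero xs _ _ = []
  All-take-∷ʳ⁺ (suc n) [] _ px = px (s≤s z≤n) ∷ All.take⁺ n []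
  All-take-∷ʳ⁺ (suc n) (y ∷ xs) (py ∷ pxs) px = py ∷ All-take-∷ʳ⁺ n xs pxs (px ∘ s≤s)

  splitLast : List A → Maybe (List A × A)
  splitLast [] = nothing
  splitLast (x ∷ xs) = just (maybe′ (map₁ (x ∷_)) ([] , x) (splitLast xs))

  splitLast-∷ʳ : ∀ xs (x : A) → splitLast (xs ∷ʳ x) ≡ just (xs , x)
  splitLast-∷ʳ [] x = refl
  splitLast-∷ʳ (y ∷ xs) x rewrite splitLast-∷ʳ xs x = refl

∷ʳ≢[] : ∀ {A : Set} (xs : List A) {x} → xs ∷ʳ x ≢ []
∷ʳ≢[] xs eq with ++-conicalʳ xs _ eq
... | ()

<ᵇ-true : ∀ {m n} → m < n → (m <ᵇ n) ≡ true
<ᵇ-true m<n = Equivalence.to T-≡ (<⇒<ᵇ m<n)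

<ᵇ-false : ∀ {m n} → n ≤ m → (m <ᵇ n) ≡ false
<ᵇ-false {m} {n} n≤m with m <ᵇ n in m<ᵇn
... | true = contradiction (<ᵇ⇒< m n (subst T (sym m<ᵇn) _)) (≤⇒≯ n≤m)
... | false = refl

suc[m∸suc[n]+n]≡m : ∀ {m n} → suc n ≤ m → suc (m ∸ suc n + n) ≡ m
suc[m∸suc[n]+n]≡m {m} {n} n<m = trans (sym (+-suc (m ∸ suc n) n)) (m∸n+n≡m n<m)

root : Tree → ℕ
root (node a _) = a

RootsBelow : ℕ → Forest → Set
RootsBelow N F = All (λ t → root t < N) F

WellLabelled : ℕ → Forest → Set
WellLabelled N F = F ≢ [] × RootsBelow N F

steps : Bool → ℕ → Forest → List Forest
steps false N F = step plus N F
steps true N F = step plus N F ++ step minus N F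

∈-attach⁻ : ∀ {N F y} → y ∈ attach N F →
  ∃[ pre ] ∃[ a ] ∃[ cs ] ∃[ rest ]
    F ≡ pre ++ node a cs ∷ rest × y ≡ pre ∷ʳ node a (cs ∷ʳ node N rest)
∈-attach⁻ {F = node a cs ∷ rest} (here refl) = [] , a , cs , rest , refl , refl
∈-attach⁻ {N} {node a cs ∷ rest} (there y∈) with ∈-map⁻ (node a cs ∷_) y∈
... | y′ , y′∈ , refl with ∈-attach⁻ {N} {rest} y′∈
... | pre , b , ds , r , refl , refl = node a cs ∷ pre , b , ds , r , refl , refl

∈-step-plus⁻ : ∀ {N F y} → y ∈ step plus N F → y ≡ F ∷ʳ node N [] ⊎ y ∈ attach N F
∈-step-plus⁻ (here refl) = inj₁ refl
∈-step-plus⁻ (there y∈) = inj₂ y∈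

∈-steps⁻ : ∀ {b N F y} → y ∈ steps b N F →
  y ≡ F ∷ʳ node N [] ⊎ y ∈ attach N F ⊎ y ≡ [ node N F ]
∈-steps⁻ {false} y∈ = ⊎-map₂ inj₁ (∈-step-plus⁻ y∈)
∈-steps⁻ {true} {N} {F} y∈ with ∈-++⁻ (step plus N F) y∈
... | inj₁ y∈plus = ⊎-map₂ inj₁ (∈-step-plus⁻ y∈plus)
... | inj₂ (here refl) = inj₂ (inj₂ refl)

attach-root< : ∀ {N F pre a cs rest} → RootsBelow N F → F ≡ pre ++ node a cs ∷ rest → a < N
attach-root< {pre = pre} roots refl = All.lookup roots (∈-++⁺ʳ pre (here refl))

attach-∌-newRoot : ∀ {N F} pre cs → RootsBelow N F → pre ∷ʳ node N cs ∉ attach N F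
attach-∌-newRoot pre cs roots y∈ with ∈-attach⁻ y∈
... | pre′ , a , cs′ , rest , F≡ , y≡ with ∷ʳ-injectiveʳ pre pre′ y≡
... | refl = <-irrefl refl (attach-root< roots F≡)

attach-unique : ∀ N F → Unique (attach N F)
attach-unique N [] = []
attach-unique N (node a cs ∷ rest) =
  All.tabulate head∉ ∷ Unique.map⁺ ∷-injectiveʳ (attach-unique N rest)
  where
  head∉ : ∀ {y} → y ∈ map (node a cs ∷_) (attach N rest) → [ node a (cs ∷ʳ node N rest) ] ≢ y
  head∉ y∈ eq with ∈-map⁻ (node a cs ∷_) y∈
  ... | y′ , y′∈ , refl with ∈-attach⁻ y′∈
  ... | pre , _ , _ , _ , _ , refl = ∷ʳ≢[] pre (sym (∷-injectiveʳ eq))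

steps-unique : ∀ b {N F} → WellLabelled N F → Unique (steps b N F)
steps-unique false {N} {F} (_ , roots) =
  All.tabulate (λ y∈ eq → attach-∌-newRoot F [] roots (subst (_∈ attach N F) (sym eq) y∈))
  ∷ attach-unique N F
steps-unique true {N} {F} (F≢[] , roots) =
  Unique.++⁺ (steps-unique false (F≢[] , roots)) ([] ∷ []) disjoint
  where
  disjoint : ∀ {y} → ¬ (y ∈ step plus N F × y ∈ step minus N F)
  disjoint (here eq , here refl) = F≢[] (∷ʳ-injectiveˡ F [] (sym eq))
  disjoint (there y∈ , here refl) = attach-∌-newRoot [] F roots y∈

steps-wellLabelled : ∀ {b N F y} → WellLabelled N F → y ∈ steps b N F → WellLabelled (suc N) y
steps-wellLabelled {b} {N} {F} (_ , roots) y∈ with ∈-steps⁻ {b} {N} {F} y∈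
... | inj₁ refl = ∷ʳ≢[] F , All.++⁺ (All.map m≤n⇒m≤1+n roots) (≤-refl ∷ [])
... | inj₂ (inj₂ refl) = (λ ()) , (≤-refl ∷ [])
... | inj₂ (inj₁ y∈attach) with ∈-attach⁻ y∈attach
...   | pre , a , cs , rest , F≡@refl , refl =
  ∷ʳ≢[] pre ,
  All.++⁺ (All.map m≤n⇒m≤1+n (All.++⁻ˡ pre roots)) (m≤n⇒m≤1+n (attach-root< roots F≡) ∷ [])

detachLastChild : ℕ → Maybe (Forest × Tree) → Forest
detachLastChild a nothing = [ node a [] ] -- junk: unreachable from the construction
detachLastChild a (just (cs , node _ rest)) = node a cs ∷ rest

unhook : ℕ → Forest → Tree → Forest
unhook N pre (node a cs) with a ≟ N
... | yes _ = pre ++ cs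
... | no _ = pre ++ detachLastChild a (splitLast cs)

deleteNewest : ℕ → Forest → Forest
deleteNewest N F = maybe′ (uncurry (unhook N)) [] (splitLast F)

deleteNewest-root : ∀ N pre cs → deleteNewest N (pre ∷ʳ node N cs) ≡ pre ++ cs
deleteNewest-root N pre cs rewrite splitLast-∷ʳ pre (node N cs) with N ≟ N
... | yes _ = refl
... | no N≢N = contradiction refl N≢N

deleteNewest-child : ∀ {N a} pre cs rest → a ≢ N →
  deleteNewest N (pre ∷ʳ node a (cs ∷ʳ node N rest)) ≡ pre ++ node a cs ∷ rest
deleteNewest-child {N} {a} pre cs rest a≢N
  rewrite splitLast-∷ʳ pre (node a (cs ∷ʳ node N rest)) with a ≟ N
... | yes a≡N = contradiction a≡N a≢N
... | no _ rewrite splitLast-∷ʳ cs (node N rest) = refl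

deleteNewest-steps : ∀ {b N F y} → RootsBelow N F → y ∈ steps b N F → deleteNewest N y ≡ F
deleteNewest-steps {b} {N} {F} roots y∈ with ∈-steps⁻ {b} {N} {F} y∈
... | inj₁ refl = trans (deleteNewest-root N F []) (++-identityʳ F)
... | inj₂ (inj₂ refl) = deleteNewest-root N [] F
... | inj₂ (inj₁ y∈attach) with ∈-attach⁻ y∈attach
...   | pre , a , cs , rest , F≡@refl , refl =
  deleteNewest-child pre cs rest (<⇒≢ (attach-root< roots F≡))

-- The forests of degree k with a word satisfying ε₂ = … = ε_n = +, each listed once:
-- n = 0 gives 𝒢, n = k − i gives 𝒢^i and n = k gives 𝒢⁰.
plusPrefixForests : ℕ → ℕ → List Forest
plusPrefixForests n zero = []
plusPrefixForests n (suc zero) = [ [ node 1 [] ] ]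
plusPrefixForests n (suc (suc m)) =
  concatMap (steps (n <ᵇ suc (suc m)) (suc (suc m))) (plusPrefixForests n (suc m))

plusPrefixForests-wellLabelled : ∀ n k {F} → F ∈ plusPrefixForests n k → WellLabelled (suc k) F
plusPrefixForests-wellLabelled n (suc zero) (here refl) = (λ ()) , (s≤s (s≤s z≤n) ∷ [])
plusPrefixForests-wellLabelled n (suc (suc m)) F∈ =
  let b = n <ᵇ suc (suc m)
      F′ , F′∈ , F∈steps = ∈-concatMap-elim {f = steps b (suc (suc m))} F∈
  in steps-wellLabelled {b} (plusPrefixForests-wellLabelled n (suc m) F′∈) F∈steps

plusPrefixForests-unique : ∀ n k → Unique (plusPrefixForests n k)
plusPrefixForests-unique n zero = []
plusPrefixForests-unique n (suc zero) = [] ∷ []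
plusPrefixForests-unique n (suc (suc m)) =
  Unique-concatMap (deleteNewest (suc (suc m)))
    (λ F∈ → steps-unique b (plusPrefixForests-wellLabelled n (suc m) F∈))
    (λ F∈ → deleteNewest-steps {b} (proj₂ (plusPrefixForests-wellLabelled n (suc m) F∈)))
    (plusPrefixForests-unique n (suc m))
  where b = n <ᵇ suc (suc m)

PlusPrefix : ℕ → List Sign → Set
PlusPrefix n w = All (_≡ plus) (take n w)

PlusPrefix-reverse-∷⁻ : ∀ n e v → PlusPrefix n (reverse (e ∷ v)) →
  PlusPrefix n (reverse v) × (suc (length v) ≤ n → e ≡ plus)
PlusPrefix-reverse-∷⁻ n e v p rewrite unfold-reverse e v with All-take-∷ʳ⁻ n (reverse v) p
... | p-v , e-ok = p-v , e-ok ∘ ≤-trans (s≤s (≤-reflexive (length-reverse v)))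

PlusPrefix-reverse-∷⁺ : ∀ n e v → PlusPrefix n (reverse v) → (suc (length v) ≤ n → e ≡ plus) →
  PlusPrefix n (reverse (e ∷ v))
PlusPrefix-reverse-∷⁺ n e v p-v e-ok rewrite unfold-reverse e v =
  All-take-∷ʳ⁺ n (reverse v) p-v (e-ok ∘ ≤-trans (s≤s (≤-reflexive (sym (length-reverse v)))))

step⊆steps : ∀ {n N e F} → (N ≤ n → e ≡ plus) → step e N F ⊆ steps (n <ᵇ N) N F
step⊆steps {n} {N} {plus} _ y∈ with n <ᵇ N
... | true = ∈-++⁺ˡ y∈
... | false = y∈
step⊆steps {n} {N} {minus} {F} e-ok y∈ with n <ᵇ N in n<ᵇN
... | true = ∈-++⁺ʳ (step plus N F) y∈
... | false with e-ok (≮⇒≥ (λ n<N → subst T n<ᵇN (<⇒<ᵇ n<N)))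
...   | ()

steps⊆step : ∀ {n N F y} → y ∈ steps (n <ᵇ N) N F → ∃[ e ] (N ≤ n → e ≡ plus) × y ∈ step e N F
steps⊆step {n} {N} {F} y∈ with n <ᵇ N in n<ᵇN
... | false = plus , (λ _ → refl) , y∈
... | true with ∈-++⁻ (step plus N F) y∈
...   | inj₁ y∈plus = plus , (λ _ → refl) , y∈plus
...   | inj₂ y∈minus =
  minus , (λ N≤n → contradiction (<ᵇ⇒< n N (subst T (sym n<ᵇN) _)) (≤⇒≯ N≤n)) , y∈minus

genRev-∷ : ∀ e v {F F′} → v ≢ [] → F′ ∈ genRev v → F ∈ step e (suc (length v)) F′ →
  F ∈ genRev (e ∷ v)
genRev-∷ e [] v≢[] _ _ = contradiction refl v≢[]
genRev-∷ e (_ ∷ _) _ F′∈ F∈ = ∈-concatMap-intro F′∈ F∈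

genRev⊆plusPrefixForests : ∀ n v → PlusPrefix n (reverse v) →
  genRev v ⊆ plusPrefixForests n (length v)
genRev⊆plusPrefixForests n (e ∷ []) _ F∈ = F∈
genRev⊆plusPrefixForests n (e ∷ v@(_ ∷ _)) p F∈ =
  let p-v , e-ok = PlusPrefix-reverse-∷⁻ n e v p
      F′ , F′∈ , F∈step = ∈-concatMap-elim {f = step e (suc (length v))} F∈
  in ∈-concatMap-intro (genRev⊆plusPrefixForests n v p-v F′∈) (step⊆steps e-ok F∈step)

plusPrefixForests⊆genRev : ∀ n k {F} → F ∈ plusPrefixForests n k →
  ∃[ v ] length v ≡ k × PlusPrefix n (reverse v) × F ∈ genRev v
plusPrefixForests⊆genRev n (suc zero) F∈ = [ plus ] , refl , All.take⁺ n (refl ∷ []) , F∈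
plusPrefixForests⊆genRev n (suc (suc m)) {F} F∈ =
  let F′ , F′∈ , F∈steps = ∈-concatMap-elim {f = steps (n <ᵇ suc (suc m)) (suc (suc m))} F∈
      v , len , p-v , F′∈genRev = plusPrefixForests⊆genRev n (suc m) F′∈
      e , e-ok , F∈step = steps⊆step {n} F∈steps
      v≢[] = λ v≡[] → 0≢1+n (trans (sym (cong length v≡[])) len)
  in e ∷ v , cong suc len ,
     PlusPrefix-reverse-∷⁺ n e v p-v (e-ok ∘ subst (λ l → suc l ≤ n) len) ,
     genRev-∷ e v v≢[] F′∈genRev (subst (λ l → F ∈ step e (suc l) F′) (sym len) F∈step)

G⊆plusPrefixForests : ∀ n w → PlusPrefix n w → G w ⊆ plusPrefixForests n (length w)
G⊆plusPrefixForests n w p F∈ =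
  subst (λ l → _ ∈ plusPrefixForests n l) (length-reverse w)
    (genRev⊆plusPrefixForests n (reverse w)
      (subst (PlusPrefix n) (sym (reverse-involutive w)) p) F∈)

plusPrefixForests⊆G : ∀ n k {F} → F ∈ plusPrefixForests n k →
  ∃[ w ] length w ≡ k × PlusPrefix n w × F ∈ G w
plusPrefixForests⊆G n k {F} F∈ =
  let v , len , p , F∈genRev = plusPrefixForests⊆genRev n k F∈
  in reverse v , trans (length-reverse v) len , p ,
     subst (λ u → F ∈ genRev u) (sym (reverse-involutive v)) F∈genRev

∈-words⁻ : ∀ k {w} → w ∈ words k → length w ≡ k
∈-words⁻ zero (here refl) = refl
∈-words⁻ (suc k) w∈
  with ∈-concatMap-elim {f = λ w → (plus ∷ w) ∷ (minus ∷ w) ∷ []} {xs = words k} w∈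
... | w′ , w′∈ , here refl = cong suc (∈-words⁻ k w′∈)
... | w′ , w′∈ , there (here refl) = cong suc (∈-words⁻ k w′∈)

∈-words⁺ : ∀ w → w ∈ words (length w)
∈-words⁺ [] = here refl
∈-words⁺ (plus ∷ w) = ∈-concatMap-intro (∈-words⁺ w) (here refl)
∈-words⁺ (minus ∷ w) = ∈-concatMap-intro (∈-words⁺ w) (there (here refl))

∈-words : ∀ {k w} → length w ≡ k → w ∈ words k
∈-words {w = w} refl = ∈-words⁺ w

module WordsOfPlusPrefix (n k : ℕ) (W : List (List Sign))
  (sound : ∀ {w} → w ∈ W → length w ≡ k × PlusPrefix n w)
  (complete : ∀ {w} → length w ≡ k → PlusPrefix n w → w ∈ W) where

  distinct-G⊆plusPrefixForests : distinct (concatMap G W) ⊆ plusPrefixForests n k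
  distinct-G⊆plusPrefixForests F∈ =
    let w , w∈ , F∈G = ∈-concatMap-elim {f = G} (Any.deduplicate⁻ _≟F_ F∈)
        len , p = sound w∈
    in subst (λ l → _ ∈ plusPrefixForests n l) len (G⊆plusPrefixForests n w p F∈G)

  plusPrefixForests⊆distinct-G : plusPrefixForests n k ⊆ distinct (concatMap G W)
  plusPrefixForests⊆distinct-G F∈ =
    let w , len , p , F∈G = plusPrefixForests⊆G n k F∈
    in Any.deduplicate⁺ _≟F_ (λ eq q → trans q (sym eq)) (∈-concatMap-intro (complete len p) F∈G)

  length-distinct-G : length (distinct (concatMap G W)) ≡ length (plusPrefixForests n k)
  length-distinct-G =
    Unique-⊆-⊇⇒length≡ (deduplicate-! _≟F_ (concatMap G W)) (plusPrefixForests-unique n k)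
      distinct-G⊆plusPrefixForests plusPrefixForests⊆distinct-G

  trees-distinct-G : length (filter isTree (distinct (concatMap G W))) ≡
                     length (filter isTree (plusPrefixForests n k))
  trees-distinct-G = Unique-⊆-⊇⇒length≡
    (Unique.filter⁺ isTree (deduplicate-! _≟F_ (concatMap G W)))
    (Unique.filter⁺ isTree (plusPrefixForests-unique n k))
    (filter⁺′ isTree isTree id {distinct (concatMap G W)} distinct-G⊆plusPrefixForests)
    (filter⁺′ isTree isTree id plusPrefixForests⊆distinct-G)

stepRootCounts : Bool → ℕ → List ℕ
stepRootCounts false m = suc m ∷ applyUpTo suc m
stepRootCounts true m = stepRootCounts false m ∷ʳ 1

plusPrefixRootCounts : ℕ → ℕ → List ℕ
plusPrefixRootCounts n zero = []
plusPrefixRootCounts n (suc zero) = [ 1 ]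
plusPrefixRootCounts n (suc (suc m)) =
  concatMap (stepRootCounts (n <ᵇ suc (suc m))) (plusPrefixRootCounts n (suc m))

plusRootCounts : ℕ → List ℕ
plusRootCounts zero = []
plusRootCounts (suc zero) = [ 1 ]
plusRootCounts (suc (suc m)) = concatMap (stepRootCounts false) (plusRootCounts (suc m))

iterateSteps : ℕ → List ℕ → List ℕ
iterateSteps zero L = L
iterateSteps (suc t) L = concatMap (stepRootCounts true) (iterateSteps t L)

trees : List ℕ → ℕ
trees L = length (filter (_≟ 1) L)

treesAfter : ℕ → List ℕ → ℕ
treesAfter t L = trees (iterateSteps t L)

attach-rootCounts : ∀ N F → map length (attach N F) ≡ applyUpTo suc (length F)
attach-rootCounts N [] = refl
attach-rootCounts N (node a cs ∷ rest) = cong (1 ∷_) (begin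
  map length (map (node a cs ∷_) (attach N rest))  ≡⟨ map-∘ (attach N rest) ⟨
  map (suc ∘ length) (attach N rest)               ≡⟨ map-∘ (attach N rest) ⟩
  map suc (map length (attach N rest))             ≡⟨ cong (map suc) (attach-rootCounts N rest) ⟩
  map suc (applyUpTo suc (length rest))            ≡⟨ map-applyUpTo suc suc (length rest) ⟩
  applyUpTo (suc ∘ suc) (length rest)              ∎)
  where open ≡-Reasoning

steps-rootCounts : ∀ b N F → map length (steps b N F) ≡ stepRootCounts b (length F)
steps-rootCounts false N F =
  cong₂ _∷_ (trans (length-++ F) (+-comm (length F) 1)) (attach-rootCounts N F)
steps-rootCounts true N F =
  trans (map-++ length (step plus N F) _) (cong (_∷ʳ 1) (steps-rootCounts false N F))

plusPrefixForests-rootCounts : ∀ n k → map length (plusPrefixForests n k) ≡ plusPrefixRootCounts n k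
plusPrefixForests-rootCounts n zero = refl
plusPrefixForests-rootCounts n (suc zero) = refl
plusPrefixForests-rootCounts n (suc (suc m)) = begin
  map length (concatMap (steps b N) Fs)         ≡⟨ map-concatMap length (steps b N) Fs ⟩
  concatMap (map length ∘ steps b N) Fs         ≡⟨ concatMap-cong (steps-rootCounts b N) Fs ⟩
  concatMap (stepRootCounts b ∘ length) Fs      ≡⟨ concatMap-map (stepRootCounts b) length Fs ⟨
  concatMap (stepRootCounts b) (map length Fs)  ≡⟨ cong (concatMap (stepRootCounts b))
                                                       (plusPrefixForests-rootCounts n (suc m)) ⟩
  plusPrefixRootCounts n (suc (suc m))          ∎
  where
  open ≡-Reasoning
  N = suc (suc m)
  b = n <ᵇ N
  Fs = plusPrefixForests n (suc m)

trees-map-length : ∀ Fs → length (filter isTree Fs) ≡ trees (map length Fs)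
trees-map-length [] = refl
trees-map-length (F ∷ Fs) with length F ≡ᵇ 1 -- what both `_≟ 1` tests reduce to
... | true = cong suc (trees-map-length Fs)
... | false = trees-map-length Fs

plusPrefixRootCounts-plus : ∀ {n} k → k ≤ n → plusPrefixRootCounts n k ≡ plusRootCounts k
plusPrefixRootCounts-plus zero _ = refl
plusPrefixRootCounts-plus (suc zero) _ = refl
plusPrefixRootCounts-plus (suc (suc m)) k≤n =
  cong₂ (concatMap ∘ stepRootCounts) (<ᵇ-false k≤n) (plusPrefixRootCounts-plus (suc m) (<⇒≤ k≤n))

plusPrefixRootCounts-unrestricted : ∀ {n} s t → n ≤ suc s →
  plusPrefixRootCounts n (suc s + t) ≡ iterateSteps t (plusPrefixRootCounts n (suc s))
plusPrefixRootCounts-unrestricted {n} s zero _ = cong (plusPrefixRootCounts n) (+-identityʳ (suc s))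
plusPrefixRootCounts-unrestricted {n} s (suc t) n≤1+s = begin
  plusPrefixRootCounts n (suc s + suc t)
    ≡⟨ cong (plusPrefixRootCounts n) (+-suc (suc s) t) ⟩
  plusPrefixRootCounts n (suc (suc s + t))
    ≡⟨ cong₂ (concatMap ∘ stepRootCounts) (<ᵇ-true n<2+s+t)
             (plusPrefixRootCounts-unrestricted s t n≤1+s) ⟩
  iterateSteps (suc t) (plusPrefixRootCounts n (suc s))
    ∎
  where
  open ≡-Reasoning
  n<2+s+t : n < suc (suc s + t)
  n<2+s+t = s≤s (≤-trans n≤1+s (m≤m+n (suc s) t))

fBinf-rootCounts : ∀ k → fBinf k ≡ trees (plusPrefixRootCounts 0 k)
fBinf-rootCounts k = begin
  fBinf k                                         ≡⟨ trees-distinct-G ⟩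
  length (filter isTree (plusPrefixForests 0 k))  ≡⟨ trees-map-length (plusPrefixForests 0 k) ⟩
  trees (map length (plusPrefixForests 0 k))      ≡⟨ cong trees (plusPrefixForests-rootCounts 0 k) ⟩
  trees (plusPrefixRootCounts 0 k)                ∎
  where
  open ≡-Reasoning
  open WordsOfPlusPrefix 0 k (words k) (λ w∈ → ∈-words⁻ k w∈ , []) (λ len _ → ∈-words len)

fBi-rootCounts : ∀ i k → fBi i k ≡ trees (plusPrefixRootCounts (k ∸ i) k)
fBi-rootCounts i k = begin
  fBi i k                                ≡⟨ trees-distinct-G ⟩
  length (filter isTree (Fs (k ∸ i)))    ≡⟨ trees-map-length (Fs (k ∸ i)) ⟩
  trees (map length (Fs (k ∸ i)))        ≡⟨ cong trees (plusPrefixForests-rootCounts (k ∸ i) k) ⟩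
  trees (plusPrefixRootCounts (k ∸ i) k) ∎
  where
  open ≡-Reasoning
  sound : ∀ {w} → w ∈ filter (prefixPlus? k i) (words k) → length w ≡ k × PlusPrefix (k ∸ i) w
  sound w∈ = let w∈words , p = ∈-filter⁻ (prefixPlus? k i) w∈ in ∈-words⁻ k w∈words , p
  open WordsOfPlusPrefix (k ∸ i) k (filter (prefixPlus? k i) (words k)) sound
    (λ len p → ∈-filter⁺ (prefixPlus? k i) (∈-words len) p)
  Fs = λ n → plusPrefixForests n k

fB0-rootCounts : ∀ k → fB0 k ≡ length (plusRootCounts k)
fB0-rootCounts k = begin
  fB0 k                                        ≡⟨ length-distinct-G ⟩
  length (plusPrefixForests k k)               ≡⟨ length-map length (plusPrefixForests k k) ⟨
  length (map length (plusPrefixForests k k))  ≡⟨ cong length (plusPrefixForests-rootCounts k k) ⟩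
  length (plusPrefixRootCounts k k)            ≡⟨ cong length (plusPrefixRootCounts-plus k ≤-refl) ⟩
  length (plusRootCounts k)                    ∎
  where
  open ≡-Reasoning
  sound : ∀ {w} → w ∈ filter allPlus? (words k) → length w ≡ k × PlusPrefix k w
  sound w∈ = let w∈words , p = ∈-filter⁻ allPlus? w∈ in ∈-words⁻ k w∈words , All.take⁺ k p
  complete : ∀ {w} → length w ≡ k → PlusPrefix k w → w ∈ filter allPlus? (words k)
  complete {w} len p =
    ∈-filter⁺ allPlus? (∈-words len) (subst allPlus (take-all k w (≤-reflexive len)) p)
  open WordsOfPlusPrefix k k (filter allPlus? (words k)) sound complete

iterateSteps-++ : ∀ t A B → iterateSteps t (A ++ B) ≡ iterateSteps t A ++ iterateSteps t B
iterateSteps-++ zero A B = refl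
iterateSteps-++ (suc t) A B =
  trans (cong (concatMap (stepRootCounts true)) (iterateSteps-++ t A B))
        (concatMap-++ (stepRootCounts true) (iterateSteps t A) (iterateSteps t B))

iterateSteps-suc : ∀ t L →
  iterateSteps (suc t) L ≡ iterateSteps t (concatMap (stepRootCounts true) L)
iterateSteps-suc zero L = refl
iterateSteps-suc (suc t) L = cong (concatMap (stepRootCounts true)) (iterateSteps-suc t L)

trees-++ : ∀ A B → trees (A ++ B) ≡ trees A + trees B
trees-++ A B = trans (cong length (filter-++ (_≟ 1) A B)) (length-++ (filter (_≟ 1) A))

treesAfter-++ : ∀ t A B → treesAfter t (A ++ B) ≡ treesAfter t A + treesAfter t B
treesAfter-++ t A B = trans (cong trees (iterateSteps-++ t A B)) (trees-++ (iterateSteps t A) _)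

treesAfter-minusSteps : ∀ t L →
  treesAfter t (concatMap (stepRootCounts true) L) ≡
  treesAfter t (concatMap (stepRootCounts false) L) + length L * treesAfter t [ 1 ]
treesAfter-minusSteps t [] = sym (+-identityʳ _)
treesAfter-minusSteps t (m ∷ L)
  rewrite treesAfter-++ t (stepRootCounts true m) (concatMap (stepRootCounts true) L)
        | treesAfter-++ t (stepRootCounts false m) [ 1 ]
        | treesAfter-++ t (stepRootCounts false m) (concatMap (stepRootCounts false) L)
        | treesAfter-minusSteps t L =
  solve 4 (λ a c s l → (a :+ c) :+ (s :+ l :* c) := (a :+ s) :+ (c :+ l :* c)) refl
    (treesAfter t (stepRootCounts false m)) (treesAfter t [ 1 ])
    (treesAfter t (concatMap (stepRootCounts false) L)) (length L)
  where open +-*-Solver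

treesAfter-suc : ∀ t L →
  treesAfter (suc t) L ≡
  treesAfter t (concatMap (stepRootCounts false) L) + length L * treesAfter t [ 1 ]
treesAfter-suc t L = trans (cong trees (iterateSteps-suc t L)) (treesAfter-minusSteps t L)

fBinf-treesAfter : ∀ t → fBinf (suc t) ≡ treesAfter t [ 1 ]
fBinf-treesAfter t =
  trans (fBinf-rootCounts (suc t)) (cong trees (plusPrefixRootCounts-unrestricted 0 t z≤n))

fBi≡fBinf : ∀ i k → 1 ≤ k → k ≤ i + 1 → fBi i k ≡ fBinf k
fBi≡fBinf i (suc t) _ k≤i+1 = begin
  fBi i (suc t)                                     ≡⟨ fBi-rootCounts i (suc t) ⟩
  trees (plusPrefixRootCounts (suc t ∸ i) (suc t))  ≡⟨ cong trees (plusPrefixRootCounts-unrestricted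
                                                                    0 t k∸i≤1) ⟩
  treesAfter t [ 1 ]                                ≡⟨ fBinf-treesAfter t ⟨
  fBinf (suc t)                                     ∎
  where
  open ≡-Reasoning
  k∸i≤1 : suc t ∸ i ≤ 1
  k∸i≤1 = ≤-trans (∸-monoˡ-≤ i k≤i+1) (≤-reflexive (m+n∸m≡n i 1))

fBi-treesAfter : ∀ n i → fBi i (suc n + i) ≡ treesAfter i (plusRootCounts (suc n))
fBi-treesAfter n i = begin
  fBi i k                                         ≡⟨ fBi-rootCounts i k ⟩
  trees (plusPrefixRootCounts (k ∸ i) k)          ≡⟨ cong (λ m → trees (plusPrefixRootCounts m k))
                                                          (m+n∸n≡m (suc n) i) ⟩
  trees (plusPrefixRootCounts (suc n) k)          ≡⟨ cong trees (plusPrefixRootCounts-unrestricted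
                                                                   n i ≤-refl) ⟩
  treesAfter i (plusPrefixRootCounts (suc n) (suc n))
                                                  ≡⟨ cong (treesAfter i) (plusPrefixRootCounts-plus
                                                                           (suc n) ≤-refl) ⟩
  treesAfter i (plusRootCounts (suc n))           ∎
  where
  open ≡-Reasoning
  k = suc n + i

sumFrom1-suc : ∀ n g → sumFrom1 (suc n) g ≡ sumFrom1 n g + g (suc n)
sumFrom1-suc n g = begin
  sum (map (g ∘ suc) (upTo (suc n)))             ≡⟨ cong (sum ∘ map (g ∘ suc)) (upTo-∷ʳ n) ⟨
  sum (map (g ∘ suc) (upTo n ∷ʳ n))              ≡⟨ cong sum (map-++ (g ∘ suc) (upTo n) [ n ]) ⟩
  sum (map (g ∘ suc) (upTo n) ++ [ g (suc n) ])  ≡⟨ sum-++ (map (g ∘ suc) (upTo n)) _ ⟩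
  sumFrom1 n g + (g (suc n) + 0)                 ≡⟨ cong (sumFrom1 n g +_) (+-identityʳ _) ⟩
  sumFrom1 n g + g (suc n)                       ∎
  where open ≡-Reasoning

fBinf-byFirstMinus : ∀ n t →
  fBinf (suc (n + t)) ≡
  treesAfter t (plusRootCounts (suc n)) + sumFrom1 n (λ j → fB0 j * fBinf (suc (n + t) ∸ j))
fBinf-byFirstMinus zero t = trans (fBinf-treesAfter t) (sym (+-identityʳ _))
fBinf-byFirstMinus (suc n) t = begin
  fBinf (suc (suc n + t))           ≡⟨ cong (fBinf ∘ suc) (+-suc n t) ⟨
  fBinf (suc (n + suc t))           ≡⟨ fBinf-byFirstMinus n (suc t) ⟩
  treesAfter (suc t) P + S          ≡⟨ cong (_+ S) (treesAfter-suc t P) ⟩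
  A + c + S                         ≡⟨ +-assoc A c S ⟩
  A + (c + S)                       ≡⟨ cong (A +_) (+-comm c S) ⟩
  A + (S + c)                       ≡⟨ cong (A +_) (cong₂ _+_ shift-sum last-term) ⟩
  A + (sumFrom1 n g + g (suc n))    ≡⟨ cong (A +_) (sumFrom1-suc n g) ⟨
  A + sumFrom1 (suc n) g            ∎
  where
  open ≡-Reasoning
  P = plusRootCounts (suc n)
  A = treesAfter t (plusRootCounts (suc (suc n)))
  c = length P * treesAfter t [ 1 ]
  S = sumFrom1 n (λ j → fB0 j * fBinf (suc (n + suc t) ∸ j))
  g = λ j → fB0 j * fBinf (suc (suc n + t) ∸ j)
  shift-sum : S ≡ sumFrom1 n g
  shift-sum = cong (λ m → sumFrom1 n (λ j → fB0 j * fBinf (suc m ∸ j))) (+-suc n t)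
  k∸n≡1+t : suc (suc n + t) ∸ suc n ≡ suc t
  k∸n≡1+t = trans (cong (_∸ n) (sym (+-suc n t))) (m+n∸m≡n n (suc t))
  last-term : c ≡ g (suc n)
  last-term =
    sym (cong₂ _*_ (fB0-rootCounts (suc n)) (trans (cong fBinf k∸n≡1+t) (fBinf-treesAfter t)))

fBi+firstMinus≡fBinf : ∀ n i → let k = suc (n + i) in
  fBi i k + sumFrom1 (k ∸ i ∸ 1) (λ j → fB0 j * fBinf (k ∸ j)) ≡ fBinf k
fBi+firstMinus≡fBinf n i = begin
  fBi i k + sumFrom1 (k ∸ i ∸ 1) g                      ≡⟨ cong₂ _+_ (fBi-treesAfter n i) bound ⟩
  treesAfter i (plusRootCounts (suc n)) + sumFrom1 n g  ≡⟨ fBinf-byFirstMinus n i ⟨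
  fBinf k                                               ∎
  where
  open ≡-Reasoning
  k = suc (n + i)
  g = λ j → fB0 j * fBinf (k ∸ j)
  bound : sumFrom1 (k ∸ i ∸ 1) g ≡ sumFrom1 n g
  bound = cong (λ m → sumFrom1 (m ∸ 1) g) (m+n∸n≡m (suc n) i)

proposition1p11 : (k i : ℕ) → 1 ≤ k → 1 ≤ i →
    (k ≤ i + 1 → fBi i k ≡ fBinf k) ×
    (i + 2 ≤ k → fBi i k + sumFrom1 (k ∸ i ∸ 1) (λ j → fB0 j * fBinf (k ∸ j)) ≡ fBinf k)
proposition1p11 k i 1≤k _ = fBi≡fBinf i k 1≤k , long -- the argument also covers i = 0
  where
  long : i + 2 ≤ k → fBi i k + sumFrom1 (k ∸ i ∸ 1) (λ j → fB0 j * fBinf (k ∸ j)) ≡ fBinf k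
  long i+2≤k rewrite sym (suc[m∸suc[n]+n]≡m (<⇒≤ (subst (_≤ k) (+-comm i 2) i+2≤k))) =
    fBi+firstMinus≡fBinf (k ∸ suc i) i
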